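{- For every integer $n>1$, there are $2^{\aleph_0}$ $(n,n)$-filling families of subsets of $\mathbb{Z}^n$.
   Context: $[k]=\{1,\dots,k\}$. $\mathbb{Z}^n$ is the graph with edges $\{x,x+e_i\}$; $\Gamma(x)=\{x\pm e_i:i\in[n]\}$. A family $\{X^i_j\}_{i\in[2],j\in[2n]}$ of subsets of $\mathbb{Z}^n$, with $X^i=\bigsqcup_j X^i_j$, is $(n,n)$-filling if it partitions $\mathbb{Z}^n$ and for each $i\in[2]$, $j\in[2n]$: if $x\in\mathbb{Z}^n\setminus X^i$ then $|\Gamma(x)\cap X^i_j|=1$, and if $x\in X^i$ then $\Gamma(x)\cap X^i=\emptyset$. -}

module Defs where

open import Data.Nat using (ℕ; _*_)
open import Data.Integer using (ℤ; +_; 0ℤ; 1ℤ) renaming (_+_ to _+ℤ_; _-_ to _-ℤ_)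
open import Data.Fin using (Fin; _≟_)
open import Data.Bool using (Bool; true; false; if_then_else_)
open import Data.Vec using (Vec; zipWith; tabulate)
open import Data.List using (List; []; _∷_; concatMap; map; allFin)
open import Data.Nat.ListAction using (sum)
open import Data.List.Membership.Propositional using (_∈_)
open import Data.Product using (Σ; _×_; _,_)
open import Relation.Nullary using (¬_; does)
open import Relation.Binary.PropositionalEquality using (_≡_)

Point : ℕ → Set
Point n = Vec ℤ n

e : ∀ {n} → Fin n → Point n
e i = tabulate (λ k → if does (k ≟ i) then 1ℤ else 0ℤ)

_⊕_ _⊖_ : ∀ {n} → Point n → Point n → Point n
x ⊕ y = zipWith _+ℤ_ x y
x ⊖ y = zipWith _-ℤ_ x y

-- Γ(x) = { x ± e_i : i ∈ [n] }, listed (the 2n points are pairwise distinct)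
Γ : ∀ {n} → Point n → List (Point n)
Γ {n} x = concatMap (λ i → (x ⊕ e i) ∷ (x ⊖ e i) ∷ []) (allFin n)

-- A family {X^i_j}, i ∈ [2], j ∈ [2n], of subsets of ℤⁿ, given by
-- characteristic functions (index i ↦ Fin 2, j ↦ Fin (2 * n)).
Family : ℕ → Set
Family n = Fin 2 → Fin (2 * n) → Point n → Bool

_∈[_,_]_ : ∀ {n} → Point n → Fin 2 → Fin (2 * n) → Family n → Set
x ∈[ i , j ] X = X i j x ≡ true

InUnion : ∀ {n} → Family n → Fin 2 → Point n → Set
InUnion {n} X i x = Σ (Fin (2 * n)) λ j → x ∈[ i , j ] X

count : ∀ {n} → Family n → Fin 2 → Fin (2 * n) → Point n → ℕ
count X i j x = sum (map (λ y → if X i j y then 1 else 0) (Γ x))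

Partitions : ∀ {n} → Family n → Set
Partitions {n} X = ∀ (x : Point n) →
  Σ (Fin 2) λ i → Σ (Fin (2 * n)) λ j → x ∈[ i , j ] X ×
    (∀ i' j' → x ∈[ i' , j' ] X → (i' ≡ i) × (j' ≡ j))

Filling : ∀ {n} → Family n → Set
Filling {n} X =
  Partitions X ×
  (∀ (i : Fin 2) (j : Fin (2 * n)) (x : Point n) → ¬ InUnion X i x → count X i j x ≡ 1) ×
  (∀ (i : Fin 2) (x : Point n) → InUnion X i x → ∀ y → y ∈ Γ x → ¬ InUnion X i y)

_≈F_ : ∀ {n} → Family n → Family n → Set
X ≈F Y = ∀ i j x → X i j x ≡ Y i j x

module Submission where

open import Defs
open import Data.Nat using (ℕ; _<_)
open import Data.Bool using (Bool)
open import Data.Product using (Σ; _×_)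
open import Relation.Binary.PropositionalEquality using (_≡_)

open import Function using (_∘_)
open import Data.Bool using (true; false; if_then_else_)
open import Data.Empty using (⊥-elim)
open import Data.Nat as ℕ using (zero; suc; s≤s; z≤n; NonZero)
import Data.Nat.Properties as ℕP
import Data.Nat.Divisibility as ℕD
import Data.Nat.Tactic.RingSolver as ℕRing
open import Data.Nat.ListAction using (sum)
open import Data.Nat.DivMod using (_mod_; m<n⇒m%n≡m)
open import Data.Integer using (ℤ; +_; -[1+_]; 0ℤ; 1ℤ; -1ℤ; _+_; _-_; _*_; -_; ∣_∣; _%ℕ_; _/ℕ_)
import Data.Integer.Properties as ℤP
open import Data.Integer.DivMod using (n%ℕd<d; a≡a%ℕn+[a/ℕn]*n)
open import Data.Integer.Divisibility.Signed
  using (_∣_; divides; _∣?_; ∣⇒∣ᵤ; ∣ᵤ⇒∣; ∣m∣n⇒∣m+n; ∣m∣n⇒∣m-n; ∣m⇒∣-m)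
import Data.Integer.Tactic.RingSolver as ℤRing
open import Data.Fin as Fin using (Fin; toℕ; combine; remQuot) renaming (zero to fz; suc to fs)
import Data.Fin.Properties as FinP
open import Data.Vec using (Vec; []; _∷_; lookup; replicate; tabulate)
import Data.Vec.Properties as VecP
open import Data.List as List using (List; []; _∷_; map; concatMap)
open import Data.List.Membership.Propositional using (_∈_)
open import Data.List.Relation.Unary.Any using (here; there)
open import Data.Product using (_,_; proj₁; proj₂; swap)
open import Relation.Binary.PropositionalEquality
  using (refl; sym; trans; cong; cong₂; subst; _≢_; module ≡-Reasoning)
open import Relation.Nullary using (¬_; does; yes; no)
open import Relation.Nullary.Decidable using (dec-true; dec-false)

-- Put N = 4n and H = 2n.  The direction weights 1, 2n-1, 3, 5, …, 2n-3 taken with both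
-- signs are the odd residues modulo N, each once; so for ℓ(x) = x₀ + (2n-1)x₁ + 3x₂ + …
-- the 2n neighbours of x carry the labels ℓ(x) + (every odd residue).  A bit pattern
-- β : ℤ → Bool twists this to lab(x) = ℓ(x) + H·β(x₀ - x₁): the neighbours x + e₀ and
-- x - e₁ have offsets 1 and 1 - H and share their twist bit, so the twist only swaps
-- their residues (likewise x - e₀, x + e₁), and the neighbour labels are still
-- lab(x) + every odd residue (neighbourhood-count).  With X^i_j = {lab ≡ 2j + i mod N}
-- a point outside X^i meets each X^i_j once and a point of X^i meets no X^i: the family
-- is filling.  On the axis points (k, 0, …, 0) the family reveals β(k), so f ↦ X_f is
-- injective; conversely a family is a Bool-valued predicate on the countable set
-- Fin 2 × Fin 2n × ℤⁿ and so embeds into ℕ → Bool.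

Σ< : ℕ → (ℕ → ℕ) → ℕ
Σ< zero    f = 0
Σ< (suc k) f = Σ< k f ℕ.+ f k

Σ<-front : ∀ k (f : ℕ → ℕ) → Σ< (suc k) f ≡ f 0 ℕ.+ Σ< k (f ∘ suc)
Σ<-front zero    f = ℕP.+-comm 0 (f 0)
Σ<-front (suc k) f =
  trans (cong (ℕ._+ f (suc k)) (Σ<-front k f)) (ℕP.+-assoc (f 0) (Σ< k (f ∘ suc)) (f (suc k)))

Σ<-cong : ∀ k {f g : ℕ → ℕ} → (∀ i → f i ≡ g i) → Σ< k f ≡ Σ< k g
Σ<-cong zero    _  = refl
Σ<-cong (suc k) eq = cong₂ ℕ._+_ (Σ<-cong k eq) (eq k)

sum-pairs : ∀ {A B : Set} (g : A → ℕ) (p q : B → A) k (f : Fin k → B) (h : ℕ → ℕ) →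
            (∀ j → g (p (f j)) ℕ.+ g (q (f j)) ≡ h (toℕ j)) →
            sum (map g (concatMap (λ b → p b ∷ q b ∷ []) (List.tabulate f))) ≡ Σ< k h
sum-pairs g p q zero    f h pair = refl
sum-pairs g p q (suc k) f h pair = begin
  g (p (f fz)) ℕ.+ (g (q (f fz)) ℕ.+ rest) ≡⟨ sym (ℕP.+-assoc (g (p (f fz))) _ rest) ⟩
  (g (p (f fz)) ℕ.+ g (q (f fz))) ℕ.+ rest ≡⟨ cong₂ ℕ._+_ (pair fz) (sum-pairs g p q k (f ∘ fs) (h ∘ suc) (pair ∘ fs)) ⟩
  h 0 ℕ.+ Σ< k (h ∘ suc)                   ≡⟨ sym (Σ<-front k h) ⟩
  Σ< (suc k) h                             ∎
  where
  open ≡-Reasoning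
  rest = sum (map g (concatMap (λ b → p b ∷ q b ∷ []) (List.tabulate (f ∘ fs))))

sum≡0⇒∈≡0 : ∀ {A : Set} (g : A → ℕ) {xs : List A} {y} → sum (map g xs) ≡ 0 → y ∈ xs → g y ≡ 0
sum≡0⇒∈≡0 g {x ∷ _} vanishes (here refl)  = ℕP.m+n≡0⇒m≡0 (g x) vanishes
sum≡0⇒∈≡0 g {x ∷ _} vanishes (there y∈xs) = sum≡0⇒∈≡0 g (ℕP.m+n≡0⇒n≡0 (g x) vanishes) y∈xs

ω : ℕ → ℤ
ω i = + suc (2 ℕ.* i)

ω-suc : ∀ i → ω (suc i) ≡ ω i + + 2
ω-suc i = cong +_ (step i)
  where
  step : ∀ i → suc (2 ℕ.* suc i) ≡ suc (2 ℕ.* i) ℕ.+ 2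
  step = ℕRing.solve-∀

ω-double : ∀ k → ω k + ω k ≡ + 2 + + (4 ℕ.* k)
ω-double k = cong +_ (double k)
  where
  double : ∀ k → suc (2 ℕ.* k) ℕ.+ suc (2 ℕ.* k) ≡ 2 ℕ.+ 4 ℕ.* k
  double = ℕRing.solve-∀

-1+ω : ∀ i → -1ℤ + ω i ≡ + (2 ℕ.* i)
-1+ω i = trans (cong (λ x → -1ℤ + x) (ℤP.pos-+ 1 (2 ℕ.* i))) (cancel (+ (2 ℕ.* i)))
  where
  cancel : ∀ x → -1ℤ + (1ℤ + x) ≡ x
  cancel = ℤRing.solve-∀

bitℤ : Bool → ℤ
bitℤ false = 0ℤ
bitℤ true  = 1ℤ

module Multiples (M : ℕ) where

  δ : ℤ → ℕ
  δ z = if does (+ M ∣? z) then 1 else 0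

  ∣⇒δ≡1 : ∀ {z} → + M ∣ z → δ z ≡ 1
  ∣⇒δ≡1 {z} M∣z rewrite dec-true (+ M ∣? z) M∣z = refl

  ∤⇒δ≡0 : ∀ {z} → ¬ (+ M ∣ z) → δ z ≡ 0
  ∤⇒δ≡0 {z} M∤z rewrite dec-false (+ M ∣? z) M∤z = refl

  does⇒∣ : ∀ {z} → does (+ M ∣? z) ≡ true → + M ∣ z
  does⇒∣ {z} holds with M ℕD.∣? ∣ z ∣ | holds
  ... | yes M∣∣z∣ | _ = ∣ᵤ⇒∣ M∣∣z∣

  ∣-shift : ∀ {z a} b → + M ∣ z - a → + M ∣ (z - b) - (a - b)
  ∣-shift {z} {a} b = subst (+ M ∣_) (shift z a b)
    where
    shift : ∀ z a b → z - a ≡ (z - b) - (a - b)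
    shift = ℤRing.solve-∀

  ∣-between : ∀ {z a b} → + M ∣ z - a → + M ∣ z - b → + M ∣ b - a
  ∣-between {z} {a} {b} M∣z-a M∣z-b = subst (+ M ∣_) (cancel z a b) (∣m∣n⇒∣m-n M∣z-a M∣z-b)
    where
    cancel : ∀ z a b → (z - a) - (z - b) ≡ b - a
    cancel = ℤRing.solve-∀

  δ-cong : ∀ {z z'} → + M ∣ z - z' → δ z ≡ δ z'
  δ-cong {z} {z'} M∣z-z' with + M ∣? z'
  ... | yes M∣z' = trans (∣⇒δ≡1 (subst (+ M ∣_) (forth z z') (∣m∣n⇒∣m+n M∣z-z' M∣z'))) (sym (∣⇒δ≡1 M∣z'))
    where
    forth : ∀ z z' → (z - z') + z' ≡ z
    forth = ℤRing.solve-∀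
  ... | no M∤z'  = trans (∤⇒δ≡0 λ (M∣z : + M ∣ z) → M∤z' (subst (+ M ∣_) (back z z') (∣m∣n⇒∣m-n M∣z M∣z-z')))
                         (sym (∤⇒δ≡0 M∤z'))
    where
    back : ∀ z z' → z - (z - z') ≡ z'
    back = ℤRing.solve-∀

  ∣-small : ∀ {z} → ∣ z ∣ ℕ.< M → + M ∣ z → z ≡ 0ℤ
  ∣-small {z} small M∣z with ∣ z ∣ in ∣z∣≡ | ∣⇒∣ᵤ M∣z
  ... | zero  | _      = ℤP.∣i∣≡0⇒i≡0 ∣z∣≡
  ... | suc _ | M∣∣z∣ = ⊥-elim (ℕD.>⇒∤ small M∣∣z∣)

  ∤-between : ∀ {k} → 0 ℕ.< k → k ℕ.< M → ¬ (+ M ∣ + k)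
  ∤-between {suc k} _ k<M M∣k with () ← ∣-small k<M M∣k

  ∤-between-neg : ∀ {k} → 0 ℕ.< k → k ℕ.< M → ¬ (+ M ∣ - + k)
  ∤-between-neg {k} 0<k k<M M∣-k =
    ∤-between 0<k k<M (subst (+ M ∣_) (ℤP.neg-involutive (+ k)) (∣m⇒∣-m M∣-k))

  residue-unique : ∀ {r r'} → r ℕ.< M → r' ℕ.< M → + M ∣ + r - + r' → r ≡ r'
  residue-unique {r} {r'} r<M r'<M M∣r-r' =
    ℤP.+-injective (ℤP.i-j≡0⇒i≡j (+ r) (+ r') (∣-small bound M∣r-r'))
    where
    bound : ∣ + r - + r' ∣ ℕ.< M
    bound = subst (ℕ._< M) (cong ∣_∣ (sym (ℤP.m-n≡m⊖n r r')))
                  (ℕP.≤-<-trans (ℤP.∣m⊝n∣≤m⊔n r r') (ℕP.⊔-lub r<M r'<M))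

  ∣-residue : ∀ z .{{_ : NonZero M}} → + M ∣ z - + (z %ℕ M)
  ∣-residue z = divides (z /ℕ M) (begin
    z - + r                       ≡⟨ cong (_- + r) (a≡a%ℕn+[a/ℕn]*n z M) ⟩
    (+ r + (z /ℕ M) * + M) - + r ≡⟨ cancel (+ r) (z /ℕ M) (+ M) ⟩
    (z /ℕ M) * + M                ∎)
    where
    open ≡-Reasoning
    r = z %ℕ M
    cancel : ∀ r q m → (r + q * m) - r ≡ q * m
    cancel = ℤRing.solve-∀

  bit-separation : ∀ {h} → 0 ℕ.< h → h ℕ.< M → ∀ b b' → + M ∣ + h * bitℤ b - + h * bitℤ b' → b ≡ b'
  bit-separation _   _   false false _ = refl
  bit-separation _   _   true  true  _ = refl
  bit-separation 0<h h<M true  false M∣ =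
    ⊥-elim (∤-between 0<h h<M (subst (+ M ∣_) (one _) M∣))
    where
    one : ∀ h → h * 1ℤ - h * 0ℤ ≡ h
    one = ℤRing.solve-∀
  bit-separation 0<h h<M false true  M∣ =
    ⊥-elim (∤-between-neg 0<h h<M (subst (+ M ∣_) (minus-one _) M∣))
    where
    minus-one : ∀ h → h * 0ℤ - h * 1ℤ ≡ - h
    minus-one = ℤRing.solve-∀

  -- Shifting by a half-period h (2h = M) only swaps the two points u + h·b, u + h·b - h,
  -- so the number of multiples of M among them does not depend on the bit b.
  half-turn : ∀ {h} → h + h ≡ + M → ∀ u b → δ (u + h * bitℤ b) ℕ.+ δ (u + h * bitℤ b - h) ≡ δ u ℕ.+ δ (u - h)
  half-turn {h} _ u false = cong₂ (λ p q → δ p ℕ.+ δ q) (unshifted u h) (unshifted-down u h)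
    where
    unshifted : ∀ u h → u + h * 0ℤ ≡ u
    unshifted = ℤRing.solve-∀
    unshifted-down : ∀ u h → u + h * 0ℤ - h ≡ u - h
    unshifted-down = ℤRing.solve-∀
  half-turn {h} h+h≡M u true = begin
    δ (u + h * 1ℤ) ℕ.+ δ (u + h * 1ℤ - h)
      ≡⟨ cong₂ ℕ._+_ (δ-cong {u + h * 1ℤ} {u - h} (divides 1ℤ period)) (cong δ (back u h)) ⟩
    δ (u - h) ℕ.+ δ u
      ≡⟨ ℕP.+-comm (δ (u - h)) (δ u) ⟩
    δ u ℕ.+ δ (u - h)
      ∎
    where
    open ≡-Reasoning
    back : ∀ u h → u + h * 1ℤ - h ≡ u
    back = ℤRing.solve-∀
    twice : ∀ u h → (u + h * 1ℤ) - (u - h) ≡ h + h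
    twice = ℤRing.solve-∀
    period : (u + h * 1ℤ) - (u - h) ≡ 1ℤ * + M
    period = trans (twice u h) (trans h+h≡M (sym (ℤP.*-identityˡ (+ M))))

  W : ℕ → ℤ → ℕ
  W k s = Σ< k (λ i → δ (s + ω i) ℕ.+ δ (s - ω i))

  W-cong : ∀ k {s t} → + M ∣ s - t → W k s ≡ W k t
  W-cong k {s} {t} M∣s-t = Σ<-cong k λ i →
    cong₂ ℕ._+_ (δ-cong {s + ω i} {t + ω i} (subst (+ M ∣_) (plus s t (ω i)) M∣s-t))
                (δ-cong {s - ω i} {t - ω i} (subst (+ M ∣_) (minus s t (ω i)) M∣s-t))
    where
    plus : ∀ s t w → s - t ≡ (s + w) - (t + w)
    plus = ℤRing.solve-∀
    minus : ∀ s t w → s - t ≡ (s - w) - (t - w)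
    minus = ℤRing.solve-∀

  -- Moving the window up by 2 loses its lowest point s - (2k - 1) = (s + 2) - (2k + 1)
  -- and gains the new top point s + (2k + 1).
  W-slide : ∀ k s → W k (s + + 2) ℕ.+ δ (s + + 2 - ω k) ≡ W k s ℕ.+ δ (s + ω k)
  W-slide zero    s = cong δ (base s)
    where
    base : ∀ s → s + + 2 - + 1 ≡ s + + 1
    base = ℤRing.solve-∀
  W-slide (suc k) s = begin
    (W k s₂ ℕ.+ (δ (s₂ + ω k) ℕ.+ δ (s₂ - ω k))) ℕ.+ δ (s₂ - ω (suc k))
      ≡⟨ cong₂ (λ a b → (W k s₂ ℕ.+ (δ a ℕ.+ δ (s₂ - ω k))) ℕ.+ δ b) top bottom ⟩
    (W k s₂ ℕ.+ (δ (s + ω (suc k)) ℕ.+ δ (s₂ - ω k))) ℕ.+ δ (s - ω k)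
      ≡⟨ regroup (W k s₂) (δ (s₂ - ω k)) (W k s) (δ (s + ω k)) (δ (s + ω (suc k))) (δ (s - ω k)) (W-slide k s) ⟩
    (W k s ℕ.+ (δ (s + ω k) ℕ.+ δ (s - ω k))) ℕ.+ δ (s + ω (suc k))
      ∎
    where
    open ≡-Reasoning
    s₂ = s + + 2
    top : s₂ + ω k ≡ s + ω (suc k)
    top = trans (move s (ω k)) (cong (λ w → s + w) (sym (ω-suc k)))
      where
      move : ∀ s w → (s + + 2) + w ≡ s + (w + + 2)
      move = ℤRing.solve-∀
    bottom : s₂ - ω (suc k) ≡ s - ω k
    bottom = trans (cong (λ w → s₂ - w) (ω-suc k)) (cancel s (ω k))
      where
      cancel : ∀ s w → (s + + 2) - (w + + 2) ≡ s - w
      cancel = ℤRing.solve-∀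
    regroup : ∀ a b c d e f → a ℕ.+ b ≡ c ℕ.+ d → (a ℕ.+ (e ℕ.+ b)) ℕ.+ f ≡ (c ℕ.+ (d ℕ.+ f)) ℕ.+ e
    regroup a b c d e f a+b≡c+d =
      trans (apart a b e f) (trans (cong (ℕ._+ (e ℕ.+ f)) a+b≡c+d) (together c d e f))
      where
      apart : ∀ a b e f → (a ℕ.+ (e ℕ.+ b)) ℕ.+ f ≡ (a ℕ.+ b) ℕ.+ (e ℕ.+ f)
      apart = ℕRing.solve-∀
      together : ∀ c d e f → (c ℕ.+ d) ℕ.+ (e ℕ.+ f) ≡ (c ℕ.+ (d ℕ.+ f)) ℕ.+ e
      together = ℕRing.solve-∀

  W-zero : ∀ k → 2 ℕ.* k ℕ.≤ M → W k 0ℤ ≡ 0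
  W-zero zero    _        = refl
  W-zero (suc k) 2k+2≤M =
    cong₂ ℕ._+_ (W-zero k (ℕP.≤-trans (ℕP.*-monoʳ-≤ 2 (ℕP.n≤1+n k)) 2k+2≤M))
                (cong₂ ℕ._+_ (∤⇒δ≡0 {ω k} (∤-between (s≤s z≤n) ω<M))
                             (∤⇒δ≡0 { - ω k} (∤-between-neg (s≤s z≤n) ω<M)))
    where
    ω<M : suc (2 ℕ.* k) ℕ.< M
    ω<M = subst (ℕ._≤ M) (ℕP.*-suc 2 k) 2k+2≤M

  -- A window of length k + 1 centred at -1 contains exactly one multiple of M, namely 0,
  -- as long as its points -2k - 2, …, 2k stay strictly inside (-M, M).
  W-minus-one : ∀ k → 2 ℕ.* suc k ℕ.< M → W (suc k) -1ℤ ≡ 1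
  W-minus-one zero    2<M =
    cong₂ (λ a b → 0 ℕ.+ (a ℕ.+ b)) (∣⇒δ≡1 {0ℤ} (divides 0ℤ refl)) (∤⇒δ≡0 { - + 2} (∤-between-neg (s≤s z≤n) 2<M))
  W-minus-one (suc k) bound =
    cong₂ ℕ._+_ (W-minus-one k smaller) (cong₂ ℕ._+_ above-zero below-zero)
    where
    smaller : 2 ℕ.* suc k ℕ.< M
    smaller = ℕP.<-trans (ℕP.*-monoʳ-< 2 (ℕP.n<1+n (suc k))) bound
    above-zero : δ (-1ℤ + ω (suc k)) ≡ 0
    above-zero = ∤⇒δ≡0 { -1ℤ + ω (suc k)} λ M∣ →
      ∤-between (s≤s z≤n) smaller (subst (+ M ∣_) (-1+ω (suc k)) M∣)
    below-zero : δ (-1ℤ - ω (suc k)) ≡ 0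
    below-zero = ∤⇒δ≡0 { - + suc (suc (2 ℕ.* suc k))}
      (∤-between-neg (s≤s z≤n) (subst (ℕ._< M) (ℕP.*-suc 2 (suc k)) bound))

  -- When M = 4k the window of length k meets every odd residue modulo M exactly once,
  -- so its count only depends on the parity of the centre.
  module Period (k : ℕ) (M≡4k : M ≡ 4 ℕ.* k) where

    -- The top point gained and the bottom point lost by sliding differ by M.
    W-period : ∀ s → W k (s + + 2) ≡ W k s
    W-period s = ℕP.+-cancelʳ-≡ (δ (s + ω k)) (W k (s + + 2)) (W k s)
      (trans (cong (W k (s + + 2) ℕ.+_) (sym ends-agree)) (W-slide k s))
      where
      open ≡-Reasoning
      difference : (s + + 2 - ω k) - (s + ω k) ≡ -1ℤ * + M
      difference = begin
        (s + + 2 - ω k) - (s + ω k)  ≡⟨ expand s (ω k) ⟩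
        + 2 - (ω k + ω k)            ≡⟨ cong (λ x → + 2 - x) (ω-double k) ⟩
        + 2 - (+ 2 + + (4 ℕ.* k))    ≡⟨ collapse (+ (4 ℕ.* k)) ⟩
        -1ℤ * + (4 ℕ.* k)            ≡⟨ cong (λ x → -1ℤ * + x) (sym M≡4k) ⟩
        -1ℤ * + M                    ∎
        where
        expand : ∀ s w → (s + + 2 - w) - (s + w) ≡ + 2 - (w + w)
        expand = ℤRing.solve-∀
        collapse : ∀ q → + 2 - (+ 2 + q) ≡ -1ℤ * q
        collapse = ℤRing.solve-∀
      ends-agree : δ (s + + 2 - ω k) ≡ δ (s + ω k)
      ends-agree = δ-cong {s + + 2 - ω k} {s + ω k} (divides -1ℤ difference)

    W-steps : ∀ s j → W k (s + + 2 * + j) ≡ W k s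
    W-steps s zero    = cong (W k) (no-step s)
      where
      no-step : ∀ s → s + + 2 * + 0 ≡ s
      no-step = ℤRing.solve-∀
    W-steps s (suc j) = begin
      W k (s + + 2 * + suc j)      ≡⟨ cong (λ v → W k (s + + 2 * v)) (ℤP.pos-+ 1 j) ⟩
      W k (s + + 2 * (1ℤ + + j))   ≡⟨ cong (W k) (one-more s (+ j)) ⟩
      W k ((s + + 2 * + j) + + 2)  ≡⟨ W-period (s + + 2 * + j) ⟩
      W k (s + + 2 * + j)          ≡⟨ W-steps s j ⟩
      W k s                        ∎
      where
      open ≡-Reasoning
      one-more : ∀ s v → s + + 2 * (1ℤ + v) ≡ (s + + 2 * v) + + 2
      one-more = ℤRing.solve-∀

    W-shift : ∀ s u → W k (s + + 2 * u) ≡ W k s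
    W-shift s (+ j)     = W-steps s j
    W-shift s -[1+ j ] =
      sym (trans (cong (W k) (back s (+ suc j))) (W-steps (s + + 2 * -[1+ j ]) (suc j)))
      where
      back : ∀ s v → s ≡ (s + + 2 * (- v)) + + 2 * v
      back = ℤRing.solve-∀

dot : ∀ {k} → Vec ℤ k → Point k → ℤ
dot []       []      = 0ℤ
dot (w ∷ ws) (z ∷ x) = w * z + dot ws x

⊕-zeros : ∀ {k} (x : Point k) → x ⊕ tabulate (λ _ → 0ℤ) ≡ x
⊕-zeros []      = refl
⊕-zeros (z ∷ x) = cong₂ _∷_ (ℤP.+-identityʳ z) (⊕-zeros x)

⊖-zeros : ∀ {k} (x : Point k) → x ⊖ tabulate (λ _ → 0ℤ) ≡ x
⊖-zeros []      = refl
⊖-zeros (z ∷ x) = cong₂ _∷_ (ℤP.+-identityʳ z) (⊖-zeros x)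

dot-⊕e : ∀ {k} (ws : Vec ℤ k) x (i : Fin k) → dot ws (x ⊕ e i) ≡ dot ws x + lookup ws i
dot-⊕e (w ∷ ws) (z ∷ x) fz =
  trans (cong (λ y → w * (z + 1ℤ) + dot ws y) (⊕-zeros x)) (step w z (dot ws x))
  where
  step : ∀ w z d → w * (z + 1ℤ) + d ≡ (w * z + d) + w
  step = ℤRing.solve-∀
dot-⊕e (w ∷ ws) (z ∷ x) (fs i) =
  trans (cong (λ d → w * (z + 0ℤ) + d) (dot-⊕e ws x i)) (step w z (dot ws x) (lookup ws i))
  where
  step : ∀ w z d l → w * (z + 0ℤ) + (d + l) ≡ (w * z + d) + l
  step = ℤRing.solve-∀

dot-⊖e : ∀ {k} (ws : Vec ℤ k) x (i : Fin k) → dot ws (x ⊖ e i) ≡ dot ws x - lookup ws i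
dot-⊖e (w ∷ ws) (z ∷ x) fz =
  trans (cong (λ y → w * (z - 1ℤ) + dot ws y) (⊖-zeros x)) (step w z (dot ws x))
  where
  step : ∀ w z d → w * (z - 1ℤ) + d ≡ (w * z + d) - w
  step = ℤRing.solve-∀
dot-⊖e (w ∷ ws) (z ∷ x) (fs i) =
  trans (cong (λ d → w * (z - 0ℤ) + d) (dot-⊖e ws x i)) (step w z (dot ws x) (lookup ws i))
  where
  step : ∀ w z d l → w * (z - 0ℤ) + (d - l) ≡ (w * z + d) - l
  step = ℤRing.solve-∀

dot-zeros : ∀ {k} (x : Point k) → dot (replicate k 0ℤ) x ≡ 0ℤ
dot-zeros []      = refl
dot-zeros (z ∷ x) = trans (ℤP.+-identityˡ _) (dot-zeros x)

module Construction (m : ℕ) (β : ℤ → Bool) where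

  n : ℕ
  n = suc (suc m)

  N : ℕ
  N = 2 ℕ.* n ℕ.* 2

  H : ℤ
  H = + (2 ℕ.* n)

  open Multiples N public

  -- Direction i gets weight ω 0, ω (n - 1), ω 1, …, ω (n - 2): all odd numbers below 2n.
  weights : Vec ℤ n
  weights = ω 0 ∷ ω (suc m) ∷ tabulate (λ j → ω (suc (toℕ j)))

  twist-axis : Vec ℤ n
  twist-axis = 1ℤ ∷ -1ℤ ∷ replicate m 0ℤ

  ℓ τ : Point n → ℤ
  ℓ = dot weights
  τ = dot twist-axis

  -- The label of x: the perfect-code labelling ℓ, shifted by a half-turn where β says so.
  lab : Point n → ℤ
  lab x = ℓ x + H * bitℤ (β (τ x))

  lab-⊕ : ∀ x i → lab (x ⊕ e i) ≡ (ℓ x + lookup weights i) + H * bitℤ (β (τ x + lookup twist-axis i))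
  lab-⊕ x i = cong₂ (λ a t → a + H * bitℤ (β t)) (dot-⊕e weights x i) (dot-⊕e twist-axis x i)

  lab-⊖ : ∀ x i → lab (x ⊖ e i) ≡ (ℓ x - lookup weights i) + H * bitℤ (β (τ x - lookup twist-axis i))
  lab-⊖ x i = cong₂ (λ a t → a + H * bitℤ (β t)) (dot-⊖e weights x i) (dot-⊖e twist-axis x i)

  -- H is a half-turn modulo N, and the two twisted weights add up to it.
  H+H≡N : H + H ≡ + N
  H+H≡N = cong +_ (double m)
    where
    double : ∀ m → 2 ℕ.* suc (suc m) ℕ.+ 2 ℕ.* suc (suc m) ≡ 2 ℕ.* suc (suc m) ℕ.* 2
    double = ℕRing.solve-∀

  ω-last+ω-first : ω (suc m) + ω 0 ≡ H
  ω-last+ω-first = cong +_ (add m)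
    where
    add : ∀ m → suc (2 ℕ.* suc m) ℕ.+ 1 ≡ 2 ℕ.* suc (suc m)
    add = ℕRing.solve-∀

  ω-last≡H-ω-first : ω (suc m) ≡ H - ω 0
  ω-last≡H-ω-first = trans (sym (cancel (ω (suc m)) (ω 0))) (cong (_- ω 0) ω-last+ω-first)
    where
    cancel : ∀ a b → (a + b) - b ≡ a
    cancel = ℤRing.solve-∀

  ω-first≡H-ω-last : ω 0 ≡ H - ω (suc m)
  ω-first≡H-ω-last = trans (sym (cancel (ω 0) (ω (suc m)))) (cong (_- ω (suc m)) ω-last+ω-first)
    where
    cancel : ∀ a b → (b + a) - b ≡ a
    cancel = ℤRing.solve-∀

  -- Two neighbours with offsets w and -w' = w - H and a common twist bit b' contribute
  -- to the count of labels ≡ c as if their twist bit were that of x (b): a half-turn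
  -- only swaps their residues.
  twisted-pair : ∀ L c w w' b b' → w' ≡ H - w →
    δ ((L + w) + H * bitℤ b' - c) ℕ.+ δ ((L - w') + H * bitℤ b' - c)
      ≡ δ ((L + H * bitℤ b - c) + w) ℕ.+ δ ((L + H * bitℤ b - c) - w')
  twisted-pair L c w .(H - w) b b' refl = begin
    δ ((L + w) + H * B' - c) ℕ.+ δ ((L - (H - w)) + H * B' - c)
      ≡⟨ cong₂ (λ p q → δ p ℕ.+ δ q) (up L w H B' c) (down L w H B' c) ⟩
    δ (z + H * B') ℕ.+ δ (z + H * B' - H)
      ≡⟨ half-turn H+H≡N z b' ⟩
    δ z ℕ.+ δ (z - H)
      ≡⟨ half-turn H+H≡N z b ⟨
    δ (z + H * B) ℕ.+ δ (z + H * B - H)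
      ≡⟨ cong₂ (λ p q → δ p ℕ.+ δ q) (up′ L w H B c) (down′ L w H B c) ⟩
    δ ((L + H * B - c) + w) ℕ.+ δ ((L + H * B - c) - (H - w))
      ∎
    where
    open ≡-Reasoning
    B B' : ℤ
    B = bitℤ b
    B' = bitℤ b'
    z = L + w - c
    up : ∀ L w h b c → (L + w) + h * b - c ≡ (L + w - c) + h * b
    up = ℤRing.solve-∀
    down : ∀ L w h b c → (L - (h - w)) + h * b - c ≡ (L + w - c) + h * b - h
    down = ℤRing.solve-∀
    up′ : ∀ L w h b c → (L + w - c) + h * b ≡ (L + h * b - c) + w
    up′ = ℤRing.solve-∀
    down′ : ∀ L w h b c → (L + w - c) + h * b - h ≡ (L + h * b - c) - (h - w)
    down′ = ℤRing.solve-∀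

  -- The remaining directions e₂, …, e_{n-1} leave τ, hence the twist bit, unchanged.
  straight-⊕ : ∀ x c (j : Fin m) → lab (x ⊕ e (fs (fs j))) - c ≡ (lab x - c) + ω (suc (toℕ j))
  straight-⊕ x c j = begin
    lab (x ⊕ e d) - c
      ≡⟨ cong (_- c) (lab-⊕ x d) ⟩
    ((ℓ x + lookup weights d) + H * bitℤ (β (τ x + lookup twist-axis d))) - c
      ≡⟨ cong₂ (λ w t → ((ℓ x + w) + H * bitℤ (β t)) - c)
               (VecP.lookup∘tabulate _ j)
               (trans (cong (λ a → τ x + a) (VecP.lookup-replicate j 0ℤ)) (ℤP.+-identityʳ (τ x))) ⟩
    ((ℓ x + ω (suc (toℕ j))) + H * bitℤ (β (τ x))) - c
      ≡⟨ reorder (ℓ x) (ω (suc (toℕ j))) (H * bitℤ (β (τ x))) c ⟩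
    (lab x - c) + ω (suc (toℕ j))
      ∎
    where
    open ≡-Reasoning
    d = fs (fs j)
    reorder : ∀ L w t c → ((L + w) + t) - c ≡ ((L + t) - c) + w
    reorder = ℤRing.solve-∀

  straight-⊖ : ∀ x c (j : Fin m) → lab (x ⊖ e (fs (fs j))) - c ≡ (lab x - c) - ω (suc (toℕ j))
  straight-⊖ x c j = begin
    lab (x ⊖ e d) - c
      ≡⟨ cong (_- c) (lab-⊖ x d) ⟩
    ((ℓ x - lookup weights d) + H * bitℤ (β (τ x - lookup twist-axis d))) - c
      ≡⟨ cong₂ (λ w t → ((ℓ x - w) + H * bitℤ (β t)) - c)
               (VecP.lookup∘tabulate _ j)
               (trans (cong (λ a → τ x - a) (VecP.lookup-replicate j 0ℤ)) (ℤP.+-identityʳ (τ x))) ⟩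
    ((ℓ x - ω (suc (toℕ j))) + H * bitℤ (β (τ x))) - c
      ≡⟨ reorder (ℓ x) (ω (suc (toℕ j))) (H * bitℤ (β (τ x))) c ⟩
    (lab x - c) - ω (suc (toℕ j))
      ∎
    where
    open ≡-Reasoning
    d = fs (fs j)
    reorder : ∀ L w t c → ((L - w) + t) - c ≡ ((L + t) - c) - w
    reorder = ℤRing.solve-∀

  -- The neighbourhood of x carries, modulo N, the labels lab x ± ω i (i < n); so the
  -- number of neighbours with label ≡ c is the window count W n (lab x - c).
  neighbourhood-count : ∀ x c → sum (map (λ y → δ (lab y - c)) (Γ x)) ≡ W n (lab x - c)
  neighbourhood-count x c = begin
    sum (map g (Γ x))
      ≡⟨ assemble (g (x ⊕ e fz)) (g (x ⊖ e fz)) (g (x ⊕ e (fs fz))) (g (x ⊖ e (fs fz)))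
                  (δ (s + ω 0)) (δ (s - ω 0)) (δ (s + ω (suc m))) (δ (s - ω (suc m)))
                  first-pair second-pair rest ⟩
    (P 0 ℕ.+ Σ< m (P ∘ suc)) ℕ.+ P (suc m)
      ≡⟨ cong (ℕ._+ P (suc m)) (Σ<-front m P) ⟨
    W n s
      ∎
    where
    open ≡-Reasoning
    g : Point n → ℕ
    g y = δ (lab y - c)
    s = lab x - c
    P : ℕ → ℕ
    P i = δ (s + ω i) ℕ.+ δ (s - ω i)
    first-pair : g (x ⊕ e fz) ℕ.+ g (x ⊖ e (fs fz)) ≡ δ (s + ω 0) ℕ.+ δ (s - ω (suc m))
    first-pair = trans (cong₂ (λ p q → δ (p - c) ℕ.+ δ (q - c)) (lab-⊕ x fz) (lab-⊖ x (fs fz)))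
                       (twisted-pair (ℓ x) c (ω 0) (ω (suc m)) (β (τ x)) (β (τ x + 1ℤ)) ω-last≡H-ω-first)
    second-pair : g (x ⊕ e (fs fz)) ℕ.+ g (x ⊖ e fz) ≡ δ (s + ω (suc m)) ℕ.+ δ (s - ω 0)
    second-pair = trans (cong₂ (λ p q → δ (p - c) ℕ.+ δ (q - c)) (lab-⊕ x (fs fz)) (lab-⊖ x fz))
                        (twisted-pair (ℓ x) c (ω (suc m)) (ω 0) (β (τ x)) (β (τ x + -1ℤ)) ω-first≡H-ω-last)
    rest : sum (map g (concatMap (λ i → x ⊕ e i ∷ x ⊖ e i ∷ []) (List.tabulate (λ j → fs (fs j)))))
           ≡ Σ< m (P ∘ suc)
    rest = sum-pairs g (λ i → x ⊕ e i) (λ i → x ⊖ e i) m (λ j → fs (fs j)) (P ∘ suc)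
             λ j → cong₂ (λ p q → δ p ℕ.+ δ q) (straight-⊕ x c j) (straight-⊖ x c j)
    assemble : ∀ a b c d u v u' v' {r r'} → a ℕ.+ d ≡ u ℕ.+ v' → c ℕ.+ b ≡ u' ℕ.+ v → r ≡ r' →
               a ℕ.+ (b ℕ.+ (c ℕ.+ (d ℕ.+ r))) ≡ ((u ℕ.+ v) ℕ.+ r') ℕ.+ (u' ℕ.+ v')
    assemble a b c d u v u' v' {r} {r'} ad cb refl =
      trans (split a b c d r) (trans (cong₂ (λ p q → (p ℕ.+ q) ℕ.+ r) ad cb) (merge u v u' v' r))
      where
      split : ∀ a b c d r → a ℕ.+ (b ℕ.+ (c ℕ.+ (d ℕ.+ r))) ≡ ((a ℕ.+ d) ℕ.+ (c ℕ.+ b)) ℕ.+ r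
      split = ℕRing.solve-∀
      merge : ∀ u v u' v' r → ((u ℕ.+ v') ℕ.+ (u' ℕ.+ v)) ℕ.+ r ≡ ((u ℕ.+ v) ℕ.+ r) ℕ.+ (u' ℕ.+ v')
      merge = ℕRing.solve-∀

  -- X^i_j consists of the points whose label is ≡ 2j + i modulo N.
  code : Fin 2 → Fin (2 ℕ.* n) → ℤ
  code i j = + toℕ (combine j i)

  X : Family n
  X i j y = does (+ N ∣? lab y - code i j)

  count-X : ∀ i j x → count X i j x ≡ W n (lab x - code i j)
  count-X i j x = neighbourhood-count x (code i j)

  code-expand : ∀ i j → code i j ≡ + toℕ i + + 2 * + toℕ j
  code-expand i j = begin
    + toℕ (combine j i)                 ≡⟨ cong +_ (FinP.toℕ-combine j i) ⟩
    + (2 ℕ.* toℕ j ℕ.+ toℕ i)           ≡⟨ ℤP.pos-+ (2 ℕ.* toℕ j) (toℕ i) ⟩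
    + (2 ℕ.* toℕ j) + + toℕ i           ≡⟨ cong (_+ + toℕ i) (ℤP.pos-* 2 (toℕ j)) ⟩
    + 2 * + toℕ j + + toℕ i             ≡⟨ ℤP.+-comm (+ 2 * + toℕ j) (+ toℕ i) ⟩
    + toℕ i + + 2 * + toℕ j             ∎
    where open ≡-Reasoning

  code-same-class : ∀ i j j' → code i j - code i j' ≡ + 2 * (+ toℕ j - + toℕ j')
  code-same-class i j j' = trans (cong₂ _-_ (code-expand i j) (code-expand i j')) (diff (+ toℕ i) (+ toℕ j) (+ toℕ j'))
    where
    diff : ∀ a b b' → (a + + 2 * b) - (a + + 2 * b') ≡ + 2 * (b - b')
    diff = ℤRing.solve-∀

  code-other-class : ∀ {i i'} → i ≢ i' → ∀ j j' → Σ ℤ λ u → code i j - code i' j' ≡ -1ℤ + + 2 * u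
  code-other-class {fz}       {fz}       0≢0 _ _ = ⊥-elim (0≢0 refl)
  code-other-class {fs fz}    {fs fz}    1≢1 _ _ = ⊥-elim (1≢1 refl)
  code-other-class {fz}       {fs fz}    _   j j' =
    + toℕ j - + toℕ j' , trans (cong₂ _-_ (code-expand fz j) (code-expand (fs fz) j')) (diff (+ toℕ j) (+ toℕ j'))
    where
    diff : ∀ b b' → (+ 0 + + 2 * b) - (+ 1 + + 2 * b') ≡ -1ℤ + + 2 * (b - b')
    diff = ℤRing.solve-∀
  code-other-class {fs fz}    {fz}       _   j j' =
    (+ toℕ j - + toℕ j') + 1ℤ , trans (cong₂ _-_ (code-expand (fs fz) j) (code-expand fz j')) (diff (+ toℕ j) (+ toℕ j'))
    where
    diff : ∀ b b' → (+ 1 + + 2 * b) - (+ 0 + + 2 * b') ≡ -1ℤ + + 2 * ((b - b') + 1ℤ)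
    diff = ℤRing.solve-∀

  residue : Point n → Fin N
  residue x = Fin.fromℕ< (n%ℕd<d (lab x) N)

  partition : Partitions X
  partition x = i , j , dec-true (+ N ∣? lab x - code i j) in-class , unique
    where
    j = proj₁ (remQuot {2 ℕ.* n} 2 (residue x))
    i = proj₂ (remQuot {2 ℕ.* n} 2 (residue x))
    code≡residue : code i j ≡ + (lab x %ℕ N)
    code≡residue = cong +_ (trans (cong toℕ (FinP.combine-remQuot {2 ℕ.* n} 2 (residue x))) (FinP.toℕ-fromℕ< _))
    in-class : + N ∣ lab x - code i j
    in-class = subst (λ r → + N ∣ lab x - r) (sym code≡residue) (∣-residue (lab x))
    unique : ∀ i' j' → x ∈[ i' , j' ] X → (i' ≡ i) × (j' ≡ j)
    unique i' j' x∈ = swap (FinP.combine-injective j' i' j i (FinP.toℕ-injective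
      (residue-unique (FinP.toℕ<n (combine j' i')) (FinP.toℕ<n (combine j i)) (∣-between {lab x} {code i j} {code i' j'} in-class (does⇒∣ {lab x - code i' j'} x∈)))))

  N≡2n+2n : N ≡ 2 ℕ.* n ℕ.+ 2 ℕ.* n
  N≡2n+2n = double m
    where
    double : ∀ m → 2 ℕ.* suc (suc m) ℕ.* 2 ≡ 2 ℕ.* suc (suc m) ℕ.+ 2 ℕ.* suc (suc m)
    double = ℕRing.solve-∀

  N≡4n : N ≡ 4 ℕ.* n
  N≡4n = quadruple m
    where
    quadruple : ∀ m → 2 ℕ.* suc (suc m) ℕ.* 2 ≡ 4 ℕ.* suc (suc m)
    quadruple = ℕRing.solve-∀

  2n<N : 2 ℕ.* n ℕ.< N
  2n<N = subst (2 ℕ.* n ℕ.<_) (sym N≡2n+2n) (ℕP.m<m+n (2 ℕ.* n) (s≤s z≤n))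

  open Period n N≡4n

  -- A point outside X^i has labels of the other parity, so it sees each X^i_j once.
  outside-count : ∀ i j x → ¬ InUnion X i x → count X i j x ≡ 1
  outside-count i j x x∉ = begin
    count X i j x                ≡⟨ count-X i j x ⟩
    W n (lab x - code i j)       ≡⟨ W-cong n {lab x - code i j} {code i' j' - code i j} (∣-shift {lab x} {code i' j'} (code i j) (does⇒∣ {lab x - code i' j'} x∈)) ⟩
    W n (code i' j' - code i j)  ≡⟨ cong (W n) (proj₂ odd) ⟩
    W n (-1ℤ + + 2 * proj₁ odd)  ≡⟨ W-shift -1ℤ (proj₁ odd) ⟩
    W n -1ℤ                      ≡⟨ W-minus-one (suc m) 2n<N ⟩
    1                            ∎
    where
    open ≡-Reasoning
    i' = proj₁ (partition x)
    j' = proj₁ (proj₂ (partition x))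
    x∈ : x ∈[ i' , j' ] X
    x∈ = proj₁ (proj₂ (proj₂ (partition x)))
    other-class : i' ≢ i
    other-class i'≡i = x∉ (j' , subst (λ k → x ∈[ k , j' ] X) i'≡i x∈)
    odd = code-other-class other-class j' j

  -- A point of X^i sees no point of X^i, as its neighbours all have the other parity.
  inside-independent : ∀ i x → InUnion X i x → ∀ y → y ∈ Γ x → ¬ InUnion X i y
  inside-independent i x (j , x∈) y y∈Γx (j' , y∈) =
    ℕP.1+n≢0 (subst (λ b → (if b then 1 else 0) ≡ 0) y∈
      (sum≡0⇒∈≡0 (λ z → if X i j' z then 1 else 0) no-neighbour y∈Γx))
    where
    open ≡-Reasoning
    u = + toℕ j - + toℕ j'
    no-neighbour : count X i j' x ≡ 0
    no-neighbour = begin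
      count X i j' x               ≡⟨ count-X i j' x ⟩
      W n (lab x - code i j')      ≡⟨ W-cong n {lab x - code i j'} {code i j - code i j'} (∣-shift {lab x} {code i j} (code i j') (does⇒∣ {lab x - code i j} x∈)) ⟩
      W n (code i j - code i j')   ≡⟨ cong (W n) (code-same-class i j j') ⟩
      W n (+ 2 * u)                ≡⟨ cong (W n) (ℤP.+-identityˡ (+ 2 * u)) ⟨
      W n (0ℤ + + 2 * u)           ≡⟨ W-shift 0ℤ u ⟩
      W n 0ℤ                       ≡⟨ W-zero n (ℕP.<⇒≤ 2n<N) ⟩
      0                            ∎

  filling : Filling X
  filling = partition , outside-count , inside-independent

extend : (ℕ → Bool) → ℤ → Bool
extend f (+ k)    = f k
extend f -[1+ _ ] = false

twisted-family : ∀ m → (ℕ → Bool) → Family (suc (suc m))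
twisted-family m f = Construction.X m (extend f)

twisted-family-filling : ∀ m f → Filling (twisted-family m f)
twisted-family-filling m f = Construction.filling m (extend f)

axis-point : ∀ m → ℕ → Point (suc (suc m))
axis-point m k = + k ∷ 0ℤ ∷ replicate m 0ℤ

τ-axis-point : ∀ m β k → Construction.τ m β (axis-point m k) ≡ + k
τ-axis-point m β k =
  trans (cong₂ _+_ (ℤP.*-identityˡ (+ k)) (trans (ℤP.+-identityˡ _) (dot-zeros (replicate m 0ℤ))))
        (ℤP.+-identityʳ (+ k))

-- On the axis point the two labellings differ exactly by H·(f k - g k); since the two
-- families share the class of that point, N divides this difference, forcing f k = g k.
twisted-family-injective : ∀ m f g → twisted-family m f ≈F twisted-family m g → ∀ k → f k ≡ g k
twisted-family-injective m f g same k =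
  F.bit-separation (s≤s z≤n) F.2n<N (f k) (g k) (subst (+ F.N ∣_) labels-differ (∣m∣n⇒∣m-n in-F in-G))
  where
  module F = Construction m (extend f)
  module G = Construction m (extend g)
  p = axis-point m k
  i = proj₁ (F.partition p)
  j = proj₁ (proj₂ (F.partition p))
  p∈F : p ∈[ i , j ] F.X
  p∈F = proj₁ (proj₂ (proj₂ (F.partition p)))
  in-F : + F.N ∣ F.lab p - F.code i j
  in-F = F.does⇒∣ {F.lab p - F.code i j} p∈F
  in-G : + F.N ∣ G.lab p - F.code i j
  in-G = F.does⇒∣ {G.lab p - F.code i j} (trans (sym (same i j p)) p∈F)
  labels-differ : (F.lab p - F.code i j) - (G.lab p - F.code i j) ≡ F.H * bitℤ (f k) - F.H * bitℤ (g k)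
  labels-differ = trans (cancel (F.ℓ p) (F.H) (bitℤ (extend f (F.τ p))) (bitℤ (extend g (F.τ p))) (F.code i j))
                        (cong (λ t → F.H * bitℤ (extend f t) - F.H * bitℤ (extend g t)) (τ-axis-point m (extend f) k))
    where
    cancel : ∀ L h a b c → ((L + h * a) - c) - ((L + h * b) - c) ≡ h * a - h * b
    cancel = ℤRing.solve-∀

record Enumeration (A : Set) : Set where
  field
    decode     : ℕ → A
    surjective : ∀ a → Σ ℕ λ k → decode k ≡ a
open Enumeration

-- Cantor's walk through ℕ × ℕ along the antidiagonals a + b = s, from (0 , s) to (s , 0).
step : ℕ × ℕ → ℕ × ℕ
step (a , zero)  = (zero , suc a)
step (a , suc b) = (suc a , b)

unpair : ℕ → ℕ × ℕ
unpair zero    = (0 , 0)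
unpair (suc k) = step (unpair k)

along-antidiagonal : ∀ {s} k → unpair k ≡ (0 , s) → ∀ a b → a ℕ.+ b ≡ s → Σ ℕ λ k' → unpair k' ≡ (a , b)
along-antidiagonal k start zero    b refl  = k , start
along-antidiagonal k start (suc a) b a+b≡s =
  let (k' , at) = along-antidiagonal k start a (suc b) (trans (ℕP.+-suc a b) a+b≡s) in suc k' , cong step at

antidiagonal-start : ∀ s → Σ ℕ λ k → unpair k ≡ (0 , s)
antidiagonal-start zero    = 0 , refl
antidiagonal-start (suc s) =
  let (k , start) = antidiagonal-start s ; (k' , at) = along-antidiagonal k start s 0 (ℕP.+-identityʳ s) in suc k' , cong step at

ℕ×ℕ-enumeration : Enumeration (ℕ × ℕ)
ℕ×ℕ-enumeration = record
  { decode     = unpair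
  ; surjective = λ (a , b) → let (k , start) = antidiagonal-start (a ℕ.+ b) in along-antidiagonal k start a b refl
  }

image : ∀ {A B : Set} (f : A → B) → (∀ b → Σ A λ a → f a ≡ b) → Enumeration A → Enumeration B
image f onto E = record
  { decode     = f ∘ decode E
  ; surjective = λ b → let (a , fa≡b) = onto b ; (k , at) = surjective E a in k , trans (cong f at) fa≡b
  }

product : ∀ {A B : Set} → Enumeration A → Enumeration B → Enumeration (A × B)
product EA EB = image (λ (k , l) → decode EA k , decode EB l) onto ℕ×ℕ-enumeration
  where
  onto = λ (a , b) → (proj₁ (surjective EA a) , proj₁ (surjective EB b)) ,
                     cong₂ _,_ (proj₂ (surjective EA a)) (proj₂ (surjective EB b))

ℤ-enumeration : Enumeration ℤ
ℤ-enumeration = image signed onto ℕ×ℕ-enumeration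
  where
  signed : ℕ × ℕ → ℤ
  signed (a , zero)  = + a
  signed (a , suc _) = -[1+ a ]
  onto : ∀ z → Σ (ℕ × ℕ) λ p → signed p ≡ z
  onto (+ a)     = (a , 0) , refl
  onto -[1+ a ] = (a , 1) , refl

Vec-enumeration : ∀ {A : Set} → Enumeration A → ∀ k → Enumeration (Vec A k)
Vec-enumeration E zero    = record { decode = λ _ → [] ; surjective = λ { [] → 0 , refl } }
Vec-enumeration E (suc k) =
  image (λ (a , v) → a ∷ v) (λ { (a ∷ v) → (a , v) , refl }) (product E (Vec-enumeration E k))

Fin-enumeration : ∀ q .{{_ : NonZero q}} → Enumeration (Fin q)
Fin-enumeration q = record { decode = _mod q ; surjective = λ i → toℕ i , mod-toℕ i }
  where
  mod-toℕ : ∀ i → toℕ i mod q ≡ i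
  mod-toℕ i = FinP.toℕ-injective (trans (FinP.toℕ-fromℕ< _) (m<n⇒m%n≡m (FinP.toℕ<n i)))

predicate-code : ∀ {A : Set} → Enumeration A → (A → Bool) → ℕ → Bool
predicate-code E P = P ∘ decode E

predicate-code-injective : ∀ {A : Set} (E : Enumeration A) P Q →
  (∀ k → predicate-code E P k ≡ predicate-code E Q k) → ∀ a → P a ≡ Q a
predicate-code-injective E P Q agree a =
  let (k , at) = surjective E a in subst (λ b → P b ≡ Q b) at (agree k)

index-enumeration : ∀ k → Enumeration (Fin 2 × Fin (2 ℕ.* suc k) × Point (suc k))
index-enumeration k =
  product (Fin-enumeration 2) (product (Fin-enumeration (2 ℕ.* suc k)) (Vec-enumeration ℤ-enumeration (suc k)))

family-code : ∀ k → Family (suc k) → ℕ → Bool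
family-code k X = predicate-code (index-enumeration k) λ (i , j , x) → X i j x

family-code-injective : ∀ k X Y → (∀ l → family-code k X l ≡ family-code k Y l) → X ≈F Y
family-code-injective k X Y agree i j x =
  predicate-code-injective (index-enumeration k) (λ (i , j , x) → X i j x) (λ (i , j , x) → Y i j x) agree (i , j , x)

lemma4p5 : ∀ (n : ℕ) → 1 < n →
    (Σ ((ℕ → Bool) → Family n) λ Φ →
        (∀ f → Filling (Φ f)) ×
        (∀ f g → Φ f ≈F Φ g → ∀ k → f k ≡ g k)) ×
    (Σ (Family n → (ℕ → Bool)) λ Ψ →
        ∀ X Y → Filling X → Filling Y → (∀ k → Ψ X k ≡ Ψ Y k) → X ≈F Y)
lemma4p5 (suc (suc m)) (s≤s (s≤s _)) =
  (twisted-family m , twisted-family-filling m , twisted-family-injective m) ,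
  (family-code (suc m) , λ X Y _ _ → family-code-injective (suc m) X Y)
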